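{- Let $l\in\mathbb{N}$ and let $x_1,x_2\in S_n$ be such that $\langle x_1,x_2\rangle$ is a non-commutative subgroup of $S_n$ of order $2^{l+1}$, with $o(x_1)=2^l$ and $o(x_2)=2$. Suppose there is $y\in S_n$ with $y^2=x_1^{ -1}$, and suppose $x_2y^{ -1}=y^{ -k}x_2$ for some odd integer $k$ with $k\not\equiv -1\pmod{2^{l+1}}$. Then $\langle x_1,x_2\rangle$ is not a perfect code of $S_n$.
   Context: $o(g)$ denotes the order of $g$. For a group $G$ and a subset $S\subseteq G\setminus\{1_G\}$ with $S=S^{ -1}$, the Cayley graph $\mathrm{Cay}(G,S)$ has vertex set $G$, with $g$ and $h$ adjacent iff $hg^{ -1}\in S$. A perfect code in a graph is a set $C$ of vertices, no two adjacent, such that every vertex outside $C$ is adjacent to exactly one vertex of $C$. A subgroup $H$ of $G$ is a perfect code of $G$ if some Cayley graph $\mathrm{Cay}(G,S)$ of $G$ has $H$ as a perfect code. -}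

module Defs where

open import Data.Nat as ℕ using (ℕ; zero; suc; _<_)
open import Data.Integer as ℤ using (ℤ; +_; -[1+_])
open import Data.Fin.Permutation using (Permutation′; _≈_; id; flip; _∘ₚ_)
open import Data.List using (List; length)
open import Data.List.Relation.Unary.All using (All)
open import Data.List.Relation.Unary.Any using (Any)
open import Data.List.Relation.Unary.AllPairs using (AllPairs)
open import Data.Product using (Σ; ∃; _×_; _,_)
open import Relation.Nullary using (¬_)
open import Relation.Binary.PropositionalEquality using (_≡_)

-- The symmetric group S_n: permutations of Fin n, with equality the
-- (library) pointwise equality _≈_, identity id, inverse flip and
-- product _·_ (composition).
Sym : ℕ → Set
Sym n = Permutation′ n

infixl 7 _·_
_·_ : ∀ {n} → Sym n → Sym n → Sym n
g · h = g ∘ₚ h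

_⁻¹ : ∀ {n} → Sym n → Sym n
g ⁻¹ = flip g

_^ᵖ_ : ∀ {n} → Sym n → ℕ → Sym n
g ^ᵖ zero = id
g ^ᵖ suc m = g · (g ^ᵖ m)

_^ᶻ_ : ∀ {n} → Sym n → ℤ → Sym n
g ^ᶻ (+ m) = g ^ᵖ m
g ^ᶻ -[1+ m ] = (g ⁻¹) ^ᵖ suc m

HasOrder : ∀ {n} → Sym n → ℕ → Set
HasOrder g m = 0 < m × (g ^ᵖ m) ≈ id × (∀ j → 0 < j → j < m → ¬ ((g ^ᵖ j) ≈ id))

data Gen {n} (a b : Sym n) : Sym n → Set where
  gen-a : Gen a b a
  gen-b : Gen a b b
  gen-1 : Gen a b id
  gen-· : ∀ {g h} → Gen a b g → Gen a b h → Gen a b (g · h)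
  gen-⁻¹ : ∀ {g} → Gen a b g → Gen a b (g ⁻¹)
  gen-≈ : ∀ {g h} → Gen a b g → g ≈ h → Gen a b h

_∈≈_ : ∀ {n} → Sym n → List (Sym n) → Set
g ∈≈ L = Any (λ h → g ≈ h) L

HasCard : ∀ {n} → (Sym n → Set) → ℕ → Set
HasCard {n} H m = Σ (List (Sym n)) λ L →
  length L ≡ m × All H L × AllPairs (λ g h → ¬ (g ≈ h)) L × (∀ g → H g → g ∈≈ L)

NonCommutative : ∀ {n} → (Sym n → Set) → Set
NonCommutative H = ∃ λ g → ∃ λ h → H g × H h × ¬ ((g · h) ≈ (h · g))

IsConnectionSet : ∀ {n} → (Sym n → Set) → Set
IsConnectionSet S =
  (∀ {g h} → S g → g ≈ h → S h) ×
  ¬ S id ×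
  (∀ g → S g → S (g ⁻¹))

Adj : ∀ {n} → (Sym n → Set) → Sym n → Sym n → Set
Adj S g h = S (h · (g ⁻¹))

IsPerfectCodeIn : ∀ {n} → (Sym n → Set) → (Sym n → Set) → Set
IsPerfectCodeIn S C =
  (∀ c c′ → C c → C c′ → ¬ Adj S c c′) ×
  (∀ g → ¬ C g → ∃ λ c → C c × Adj S g c × (∀ c′ → C c′ → Adj S g c′ → c′ ≈ c))

IsPerfectCodeOfSym : ∀ {n} → (Sym n → Set) → Set₁
IsPerfectCodeOfSym {n} H = Σ (Sym n → Set) λ S → IsConnectionSet S × IsPerfectCodeIn S H

{-# OPTIONS --safe #-}
-- The subgroup H = ⟨x₁, x₂⟩ lies in ⟨y, x₂⟩, where x₂ y x₂⁻¹ = y^k. It consists exactly of the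
-- elements y^e and y^e x₂ with e even, so y ∉ H, while h ↦ y h⁻¹ y maps H to itself. If H were a
-- perfect code in Cay(S_n, S), then, since S = S⁻¹, the unique neighbour c ∈ H of y would be fixed
-- by this map, which makes c y⁻¹ an involution. But H y⁻¹ contains no involution: (y^u)² = x₁^(-u)
-- with u odd is not 1 because o(x₁) = 2^l ≥ 2 (k + 1 is even but not divisible by 2^(l+1)), and
-- (y^m x₂)² = y^((k+1) m) with m odd is 1 only if 2^(l+1) divides k + 1.
module Submission where

open import Level using (0ℓ)
open import Algebra.Bundles using (Group)
open import Data.Empty using (⊥-elim)
open import Data.Nat using (ℕ; _^_; suc; zero)
import Data.Nat as ℕ
import Data.Nat.Properties as ℕ
import Data.Nat.Divisibility as ℕ
open import Data.Nat.Primality using (Prime; euclidsLemma; prime⇒nonZero; prime[2])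
open import Data.Integer using (ℤ; +_; -_; _+_; -[1+_]; 0ℤ; 1ℤ; -1ℤ)
import Data.Integer as ℤ
import Data.Integer.Properties as ℤ
import Data.Integer.DivMod as ℤ
open import Data.Integer.Divisibility.Signed
  using (divides; ∣ᵤ⇒∣; ∣⇒∣ᵤ; ∣-trans; ∣m∣n⇒∣m+n; ∣m+n∣m⇒∣n; ∣m⇒∣-m; ∣n⇒∣m*n; *-monoˡ-∣)
  renaming (_∣_ to _∣ₛ_)
open import Data.Integer.Tactic.RingSolver using (solve-∀)
open import Data.Product using (∃; _×_; _,_; proj₁; proj₂)
open import Data.Sum using (_⊎_; inj₁; inj₂)
open import Function using (_∘_)
open import Relation.Nullary using (¬_)
open import Relation.Binary.PropositionalEquality as ≡ using (_≡_)

∣m⇒∤n⇒∤m+n : ∀ {d m n} → d ∣ₛ m → ¬ d ∣ₛ n → ¬ d ∣ₛ m + n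
∣m⇒∤n⇒∤m+n d∣m d∤n d∣m+n = d∤n (∣m+n∣m⇒∣n d∣m+n d∣m)

∤m⇒∤-m : ∀ {d m} → ¬ d ∣ₛ m → ¬ d ∣ₛ - m
∤m⇒∤-m {m = m} d∤m d∣-m = d∤m (≡.subst (_ ∣ₛ_) (ℤ.neg-involutive m) (∣m⇒∣-m d∣-m))

2∤1 : ¬ + 2 ∣ₛ 1ℤ
2∤1 2∣1 with ℕ.∣1⇒≡1 (∣⇒∣ᵤ 2∣1)
... | ()

2∤i⇒2∣i+1 : ∀ {i} → ¬ + 2 ∣ₛ i → + 2 ∣ₛ i + 1ℤ
2∤i⇒2∣i+1 {i} 2∤i with i ℤ.%ℕ 2 | ℤ.n%ℕd<d i 2 | ℤ.a≡a%ℕn+[a/ℕn]*n i 2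
... | 0 | _ | i≡0+q*2 = ⊥-elim (2∤i (divides (i ℤ./ℕ 2) (≡.trans i≡0+q*2 (ℤ.+-identityˡ _))))
... | 1 | _ | i≡1+q*2 = divides (i ℤ./ℕ 2 + 1ℤ) (≡.trans (≡.cong (_+ 1ℤ) i≡1+q*2) (shift (i ℤ./ℕ 2)))
  where
  shift : ∀ q → + 1 + q ℤ.* + 2 + + 1 ≡ (q + + 1) ℤ.* + 2
  shift = solve-∀
... | suc (suc _) | ℕ.s≤s (ℕ.s≤s ()) | _

pˡ∣m*n⇒pˡ∣n : ∀ {p m n} l → Prime p → ¬ p ℕ.∣ m → p ^ l ℕ.∣ m ℕ.* n → p ^ l ℕ.∣ n
pˡ∣m*n⇒pˡ∣n {n = n} zero _ _ _ = ℕ.1∣ n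
pˡ∣m*n⇒pˡ∣n {p} {m} {n} (suc l) p-prime p∤m pˡ⁺¹∣mn
  with euclidsLemma m n p-prime (ℕ.∣-trans (ℕ.m∣m*n (p ^ l)) pˡ⁺¹∣mn)
... | inj₁ p∣m = ⊥-elim (p∤m p∣m)
... | inj₂ (ℕ.divides n′ ≡.refl) =
  ≡.subst (p ^ suc l ℕ.∣_) (ℕ.*-comm p n′) (ℕ.*-monoʳ-∣ p (pˡ∣m*n⇒pˡ∣n l p-prime p∤m pˡ∣mn′))
  where
  instance _ = prime⇒nonZero p-prime
  m*[n′*p]≡p*[m*n′] : m ℕ.* (n′ ℕ.* p) ≡ p ℕ.* (m ℕ.* n′)
  m*[n′*p]≡p*[m*n′] = ≡.trans (≡.sym (ℕ.*-assoc m n′ p)) (ℕ.*-comm (m ℕ.* n′) p)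
  pˡ∣mn′ : p ^ l ℕ.∣ m ℕ.* n′
  pˡ∣mn′ = ℕ.*-cancelˡ-∣ p (≡.subst (p ^ suc l ℕ.∣_) m*[n′*p]≡p*[m*n′] pˡ⁺¹∣mn)

pˡ∣i*j⇒pˡ∣j : ∀ {p i j} l → Prime p → ¬ + p ∣ₛ i → + (p ^ l) ∣ₛ i ℤ.* j → + (p ^ l) ∣ₛ j
pˡ∣i*j⇒pˡ∣j {i = i} {j} l p-prime p∤i pˡ∣ij = ∣ᵤ⇒∣ (pˡ∣m*n⇒pˡ∣n l p-prime (p∤i ∘ ∣ᵤ⇒∣)
  (≡.subst (_ ℕ.∣_) (ℤ.abs-* i j) (∣⇒∣ᵤ pˡ∣ij)))

module GroupIdentities {c ℓ} (G : Group c ℓ) where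

  open Group G
  open import Algebra.Properties.Group G using (inverseʳ-unique; ⁻¹-anti-homo-∙; ⁻¹-involutive)
  open import Relation.Binary.Reasoning.Setoid setoid

  conj-homo : ∀ x g h → x ∙ (g ∙ h) ∙ x ⁻¹ ≈ (x ∙ g ∙ x ⁻¹) ∙ (x ∙ h ∙ x ⁻¹)
  conj-homo x g h = begin
    x ∙ (g ∙ h) ∙ x ⁻¹                 ≈⟨ ∙-congʳ (assoc x g h) ⟨
    x ∙ g ∙ h ∙ x ⁻¹                   ≈⟨ ∙-congʳ (∙-congˡ (identityˡ h)) ⟨
    x ∙ g ∙ (ε ∙ h) ∙ x ⁻¹             ≈⟨ ∙-congʳ (∙-congˡ (∙-congʳ (inverseˡ x))) ⟨
    x ∙ g ∙ (x ⁻¹ ∙ x ∙ h) ∙ x ⁻¹      ≈⟨ ∙-congʳ (∙-congˡ (assoc _ x h)) ⟩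
    x ∙ g ∙ (x ⁻¹ ∙ (x ∙ h)) ∙ x ⁻¹    ≈⟨ ∙-congʳ (assoc _ _ _) ⟨
    x ∙ g ∙ x ⁻¹ ∙ (x ∙ h) ∙ x ⁻¹      ≈⟨ assoc _ _ _ ⟩
    (x ∙ g ∙ x ⁻¹) ∙ (x ∙ h ∙ x ⁻¹)    ∎

  conj-⁻¹ : ∀ x g → (x ∙ g ∙ x ⁻¹) ⁻¹ ≈ x ∙ g ⁻¹ ∙ x ⁻¹
  conj-⁻¹ x g = sym (inverseʳ-unique _ _ (begin
    (x ∙ g ∙ x ⁻¹) ∙ (x ∙ g ⁻¹ ∙ x ⁻¹)   ≈⟨ conj-homo x g (g ⁻¹) ⟨
    x ∙ (g ∙ g ⁻¹) ∙ x ⁻¹                ≈⟨ ∙-congʳ (∙-congˡ (inverseʳ g)) ⟩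
    x ∙ ε ∙ x ⁻¹                         ≈⟨ ∙-congʳ (identityʳ x) ⟩
    x ∙ x ⁻¹                             ≈⟨ inverseʳ x ⟩
    ε                                    ∎))

  [c∙g⁻¹]⁻¹≈[g∙c⁻¹∙g]∙g⁻¹ : ∀ c g → (c ∙ g ⁻¹) ⁻¹ ≈ (g ∙ c ⁻¹ ∙ g) ∙ g ⁻¹
  [c∙g⁻¹]⁻¹≈[g∙c⁻¹∙g]∙g⁻¹ c g = begin
    (c ∙ g ⁻¹) ⁻¹              ≈⟨ ⁻¹-anti-homo-∙ c (g ⁻¹) ⟩
    g ⁻¹ ⁻¹ ∙ c ⁻¹             ≈⟨ ∙-congʳ (⁻¹-involutive g) ⟩
    g ∙ c ⁻¹                   ≈⟨ identityʳ _ ⟨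
    g ∙ c ⁻¹ ∙ ε               ≈⟨ ∙-congˡ (inverseʳ g) ⟨
    g ∙ c ⁻¹ ∙ (g ∙ g ⁻¹)      ≈⟨ assoc _ _ _ ⟨
    (g ∙ c ⁻¹ ∙ g) ∙ g ⁻¹      ∎

  x⁻¹≈x⇒x∙x≈ε : ∀ {x} → x ⁻¹ ≈ x → x ∙ x ≈ ε
  x⁻¹≈x⇒x∙x≈ε {x} x⁻¹≈x = trans (∙-congˡ (sym x⁻¹≈x)) (inverseʳ x)

module IntegerPowers {c ℓ} (G : Group c ℓ) where

  open Group G
  open import Algebra.Properties.Group G using (inverseˡ-unique; ∙-cancelʳ)
  open GroupIdentities G using (conj-homo)
  open import Algebra.Properties.Monoid.Mult monoid
    using (×-congʳ; ×-congˡ; ×-homo-+; ×-homo-1) renaming (_×_ to _×ᵐ_)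
  open import Relation.Binary.Reasoning.Setoid setoid

  infixr 9 _^ℤ_

  _^ℤ_ : Carrier → ℤ → Carrier
  g ^ℤ (+ m)    = m ×ᵐ g
  g ^ℤ -[1+ m ] = suc m ×ᵐ (g ⁻¹)

  ^ℤ-cong : ∀ a {g h} → g ≈ h → g ^ℤ a ≈ h ^ℤ a
  ^ℤ-cong (+ m)    g≈h = ×-congʳ m g≈h
  ^ℤ-cong -[1+ m ] g≈h = ×-congʳ (suc m) (⁻¹-cong g≈h)

  ×ᵐ-comm : ∀ m g → g ∙ m ×ᵐ g ≈ m ×ᵐ g ∙ g
  ×ᵐ-comm m g = begin
    suc m ×ᵐ g        ≈⟨ ×-congˡ (ℕ.+-comm 1 m) ⟩
    (m ℕ.+ 1) ×ᵐ g    ≈⟨ ×-homo-+ g m 1 ⟩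
    m ×ᵐ g ∙ 1 ×ᵐ g   ≈⟨ ∙-congˡ (×-homo-1 g) ⟩
    m ×ᵐ g ∙ g        ∎

  ×ᵐ⁻¹-cancelʳ : ∀ m g → m ×ᵐ (g ⁻¹) ≈ suc m ×ᵐ (g ⁻¹) ∙ g
  ×ᵐ⁻¹-cancelʳ m g = begin
    m ×ᵐ (g ⁻¹)                ≈⟨ identityʳ _ ⟨
    m ×ᵐ (g ⁻¹) ∙ ε            ≈⟨ ∙-congˡ (inverseˡ g) ⟨
    m ×ᵐ (g ⁻¹) ∙ (g ⁻¹ ∙ g)   ≈⟨ assoc _ _ _ ⟨
    m ×ᵐ (g ⁻¹) ∙ g ⁻¹ ∙ g     ≈⟨ ∙-congʳ (×ᵐ-comm m (g ⁻¹)) ⟨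
    suc m ×ᵐ (g ⁻¹) ∙ g        ∎

  ^ℤ-suc : ∀ g a → g ^ℤ ℤ.suc a ≈ g ^ℤ a ∙ g
  ^ℤ-suc g (+ m)         = ×ᵐ-comm m g
  ^ℤ-suc g -[1+ zero ]   = ×ᵐ⁻¹-cancelʳ 0 g
  ^ℤ-suc g -[1+ suc m ]  = ×ᵐ⁻¹-cancelʳ (suc m) g

  -- The power laws below all follow from this: φ with φ (a + 1) ≈ φ a ∙ g is determined by φ 0.
  ^ℤ-unique : ∀ {g h} (φ : ℤ → Carrier) → φ 0ℤ ≈ h → (∀ a → φ (ℤ.suc a) ≈ φ a ∙ g) →
              ∀ a → φ a ≈ h ∙ g ^ℤ a
  ^ℤ-unique {g} {h} φ φ0≈h φ-suc = go
    where
    base : φ 0ℤ ≈ h ∙ g ^ℤ 0ℤ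
    base = trans φ0≈h (sym (identityʳ h))

    forward : ∀ a → φ a ≈ h ∙ g ^ℤ a → φ (ℤ.suc a) ≈ h ∙ g ^ℤ ℤ.suc a
    forward a eq = begin
      φ (ℤ.suc a)        ≈⟨ φ-suc a ⟩
      φ a ∙ g            ≈⟨ ∙-congʳ eq ⟩
      h ∙ g ^ℤ a ∙ g     ≈⟨ assoc h (g ^ℤ a) g ⟩
      h ∙ (g ^ℤ a ∙ g)   ≈⟨ ∙-congˡ (^ℤ-suc g a) ⟨
      h ∙ g ^ℤ ℤ.suc a   ∎

    backward : ∀ a → φ (ℤ.suc a) ≈ h ∙ g ^ℤ ℤ.suc a → φ a ≈ h ∙ g ^ℤ a
    backward a eq = ∙-cancelʳ g _ _ (begin
      φ a ∙ g            ≈⟨ φ-suc a ⟨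
      φ (ℤ.suc a)        ≈⟨ eq ⟩
      h ∙ g ^ℤ ℤ.suc a   ≈⟨ ∙-congˡ (^ℤ-suc g a) ⟩
      h ∙ (g ^ℤ a ∙ g)   ≈⟨ assoc h (g ^ℤ a) g ⟨
      h ∙ g ^ℤ a ∙ g     ∎)

    go : ∀ a → φ a ≈ h ∙ g ^ℤ a
    go (+ zero)       = base
    go (+ suc m)      = forward (+ m) (go (+ m))
    go -[1+ zero ]    = backward -[1+ 0 ] base
    go -[1+ suc m ]   = backward -[1+ suc m ] (go -[1+ m ])

  ^ℤ-homo-+ : ∀ g a b → g ^ℤ (a + b) ≈ g ^ℤ a ∙ g ^ℤ b
  ^ℤ-homo-+ g a = ^ℤ-unique (λ b → g ^ℤ (a + b)) (reflexive (≡.cong (g ^ℤ_) (ℤ.+-identityʳ a))) step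
    where
    step : ∀ b → g ^ℤ (a + ℤ.suc b) ≈ g ^ℤ (a + b) ∙ g
    step b = begin
      g ^ℤ (a + ℤ.suc b)   ≡⟨ ≡.cong (g ^ℤ_) (+-suc a b) ⟩
      g ^ℤ ℤ.suc (a + b)   ≈⟨ ^ℤ-suc g (a + b) ⟩
      g ^ℤ (a + b) ∙ g     ∎
      where
      +-suc : ∀ a b → a + (+ 1 + b) ≡ + 1 + (a + b)
      +-suc = solve-∀

  ^ℤ-neg : ∀ g a → g ^ℤ (- a) ≈ (g ^ℤ a) ⁻¹
  ^ℤ-neg g a = inverseˡ-unique _ _ (begin
    g ^ℤ (- a) ∙ g ^ℤ a   ≈⟨ ^ℤ-homo-+ g (- a) a ⟨
    g ^ℤ (- a + a)        ≡⟨ ≡.cong (g ^ℤ_) (ℤ.+-inverseˡ a) ⟩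
    ε                     ∎)

  ^ℤ-homo-* : ∀ g a b → g ^ℤ (a ℤ.* b) ≈ (g ^ℤ a) ^ℤ b
  ^ℤ-homo-* g a b = trans (^ℤ-unique (λ b → g ^ℤ (a ℤ.* b)) φ0≈ε step b) (identityˡ _)
    where
    φ0≈ε : g ^ℤ (a ℤ.* 0ℤ) ≈ ε
    φ0≈ε = reflexive (≡.cong (g ^ℤ_) (ℤ.*-zeroʳ a))

    step : ∀ b → g ^ℤ (a ℤ.* ℤ.suc b) ≈ g ^ℤ (a ℤ.* b) ∙ g ^ℤ a
    step b = begin
      g ^ℤ (a ℤ.* ℤ.suc b)   ≡⟨ ≡.cong (g ^ℤ_) (≡.trans (ℤ.*-suc a b) (ℤ.+-comm a (a ℤ.* b))) ⟩
      g ^ℤ (a ℤ.* b + a)     ≈⟨ ^ℤ-homo-+ g (a ℤ.* b) a ⟩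
      g ^ℤ (a ℤ.* b) ∙ g ^ℤ a ∎

  ε^ℤ≈ε : ∀ a → ε ^ℤ a ≈ ε
  ε^ℤ≈ε a = sym (trans (^ℤ-unique (λ _ → ε) refl (λ _ → sym (identityʳ ε)) a) (identityˡ _))

  ∙-^ℤ-comm : ∀ g a → g ∙ g ^ℤ a ≈ g ^ℤ a ∙ g
  ∙-^ℤ-comm g a = begin
    g ∙ g ^ℤ a           ≈⟨ ∙-congʳ (identityʳ g) ⟨
    g ^ℤ 1ℤ ∙ g ^ℤ a     ≈⟨ ^ℤ-homo-+ g 1ℤ a ⟨
    g ^ℤ ℤ.suc a         ≈⟨ ^ℤ-suc g a ⟩
    g ^ℤ a ∙ g           ∎

  ^ℤ-conj : ∀ x g a → x ∙ g ^ℤ a ∙ x ⁻¹ ≈ (x ∙ g ∙ x ⁻¹) ^ℤ a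
  ^ℤ-conj x g a = trans (^ℤ-unique (λ a → x ∙ g ^ℤ a ∙ x ⁻¹) φ0≈ε step a) (identityˡ _)
    where
    φ0≈ε : x ∙ ε ∙ x ⁻¹ ≈ ε
    φ0≈ε = trans (∙-congʳ (identityʳ x)) (inverseʳ x)

    step : ∀ a → x ∙ g ^ℤ ℤ.suc a ∙ x ⁻¹ ≈ (x ∙ g ^ℤ a ∙ x ⁻¹) ∙ (x ∙ g ∙ x ⁻¹)
    step a = trans (∙-congʳ (∙-congˡ (^ℤ-suc g a))) (conj-homo x (g ^ℤ a) g)

  order-∣ : ∀ {g m} → 0 ℕ.< m → g ^ℤ (+ m) ≈ ε → (∀ r → r ℕ.< m → g ^ℤ (+ r) ≈ ε → r ≡ 0) →
            ∀ {a} → g ^ℤ a ≈ ε → + m ∣ₛ a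
  order-∣ {g} {m} 0<m gᵐ≈ε minimal {a} gᵃ≈ε =
    divides q (≡.trans a≡r+q*m (≡.trans (≡.cong (λ t → + t + q ℤ.* + m) r≡0) (ℤ.+-identityˡ _)))
    where
    instance _ = ℕ.>-nonZero 0<m
    r = a ℤ.%ℕ m
    q = a ℤ./ℕ m

    a≡r+q*m : a ≡ + r + q ℤ.* + m
    a≡r+q*m = ℤ.a≡a%ℕn+[a/ℕn]*n a m

    gʳ≈ε : g ^ℤ (+ r) ≈ ε
    gʳ≈ε = begin
      g ^ℤ (+ r)                        ≈⟨ identityʳ _ ⟨
      g ^ℤ (+ r) ∙ ε                    ≈⟨ ∙-congˡ (ε^ℤ≈ε q) ⟨
      g ^ℤ (+ r) ∙ ε ^ℤ q               ≈⟨ ∙-congˡ (^ℤ-cong q gᵐ≈ε) ⟨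
      g ^ℤ (+ r) ∙ (g ^ℤ (+ m)) ^ℤ q    ≈⟨ ∙-congˡ (^ℤ-homo-* g (+ m) q) ⟨
      g ^ℤ (+ r) ∙ g ^ℤ (+ m ℤ.* q)     ≡⟨ ≡.cong (λ e → g ^ℤ (+ r) ∙ g ^ℤ e) (ℤ.*-comm (+ m) q) ⟩
      g ^ℤ (+ r) ∙ g ^ℤ (q ℤ.* + m)     ≈⟨ ^ℤ-homo-+ g (+ r) (q ℤ.* + m) ⟨
      g ^ℤ (+ r + q ℤ.* + m)            ≡⟨ ≡.cong (g ^ℤ_) a≡r+q*m ⟨
      g ^ℤ a                            ≈⟨ gᵃ≈ε ⟩
      ε                                 ∎

    r≡0 : r ≡ 0
    r≡0 = minimal r (ℤ.n%ℕd<d a m) gʳ≈ε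

module _ {c ℓ} (G : Group c ℓ) where

  open Group G
  open import Algebra.Properties.Group G
    using (inverseˡ-unique; ⁻¹-involutive; ⁻¹-anti-homo-∙; ⁻¹-injective; \\-leftDividesʳ)
  open GroupIdentities G using (conj-⁻¹)
  open IntegerPowers G
  open import Relation.Binary.Reasoning.Setoid setoid

  module SquareRootCoset {x₁ x₂ y : Carrier} {k : ℤ} {l : ℕ}
    (x₁-order : ∀ {a} → x₁ ^ℤ a ≈ ε → + (2 ^ l) ∣ₛ a)
    (x₂∙x₂≈ε : x₂ ∙ x₂ ≈ ε)
    (y∙y≈x₁⁻¹ : y ∙ y ≈ x₁ ⁻¹)
    (x₂∙y⁻¹≈y^-k∙x₂ : x₂ ∙ y ⁻¹ ≈ y ^ℤ (- k) ∙ x₂)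
    (2∤k : ¬ + 2 ∣ₛ k)
    (2^[l+1]∤k+1 : ¬ + (2 ^ suc l) ∣ₛ k + 1ℤ)
    where

    2∣k+1 : + 2 ∣ₛ k + 1ℤ
    2∣k+1 = 2∤i⇒2∣i+1 2∤k

    2∣2^l : + 2 ∣ₛ + (2 ^ l)
    2∣2^l = 2^[j+1]∤k+1⇒2∣2^j l 2^[l+1]∤k+1
      where
      2^[j+1]∤k+1⇒2∣2^j : ∀ j → ¬ + (2 ^ suc j) ∣ₛ k + 1ℤ → + 2 ∣ₛ + (2 ^ j)
      2^[j+1]∤k+1⇒2∣2^j zero    2∤k+1 = ⊥-elim (2∤k+1 2∣k+1)
      2^[j+1]∤k+1⇒2∣2^j (suc j) _     = ∣ᵤ⇒∣ (ℕ.m∣m*n (2 ^ j))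

    x₁≈y^-2 : x₁ ≈ y ^ℤ -[1+ 1 ]
    x₁≈y^-2 = begin
      x₁                ≈⟨ ⁻¹-involutive x₁ ⟨
      x₁ ⁻¹ ⁻¹          ≈⟨ ⁻¹-cong y∙y≈x₁⁻¹ ⟨
      (y ∙ y) ⁻¹        ≈⟨ ⁻¹-cong (∙-congˡ (identityʳ y)) ⟨
      (y ^ℤ (+ 2)) ⁻¹   ≈⟨ ^ℤ-neg y (+ 2) ⟨
      y ^ℤ -[1+ 1 ]     ∎

    y^[q*2]≈x₁⁻¹^q : ∀ q → y ^ℤ (q ℤ.* + 2) ≈ (x₁ ⁻¹) ^ℤ q
    y^[q*2]≈x₁⁻¹^q q = begin
      y ^ℤ (q ℤ.* + 2)      ≡⟨ ≡.cong (y ^ℤ_) (ℤ.*-comm q (+ 2)) ⟩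
      y ^ℤ (+ 2 ℤ.* q)      ≈⟨ ^ℤ-homo-* y (+ 2) q ⟩
      (y ^ℤ (+ 2)) ^ℤ q     ≈⟨ ^ℤ-cong q (trans (∙-congˡ (identityʳ y)) y∙y≈x₁⁻¹) ⟩
      (x₁ ⁻¹) ^ℤ q          ∎

    y^[q*2]≈ε⇒2^l∣q : ∀ {q} → y ^ℤ (q ℤ.* + 2) ≈ ε → + (2 ^ l) ∣ₛ q
    y^[q*2]≈ε⇒2^l∣q {q} y^[q*2]≈ε =
      ≡.subst (_ ∣ₛ_) (ℤ.neg-involutive q) (∣m⇒∣-m (x₁-order (begin
        x₁ ^ℤ (- q)                ≈⟨ ^ℤ-cong (- q) x₁≈y^-2 ⟩
        (y ^ℤ -[1+ 1 ]) ^ℤ (- q)   ≈⟨ ^ℤ-homo-* y -[1+ 1 ] (- q) ⟨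
        y ^ℤ (-[1+ 1 ] ℤ.* - q)    ≡⟨ ≡.cong (y ^ℤ_) (-2*-q≡q*2 q) ⟩
        y ^ℤ (q ℤ.* + 2)           ≈⟨ y^[q*2]≈ε ⟩
        ε                          ∎)))
      where
      -2*-q≡q*2 : ∀ q → -[1+ 1 ] ℤ.* - q ≡ q ℤ.* + 2
      -2*-q≡q*2 = solve-∀

    y-conj : x₂ ∙ y ∙ x₂ ⁻¹ ≈ y ^ℤ k
    y-conj = ⁻¹-injective (begin
      (x₂ ∙ y ∙ x₂ ⁻¹) ⁻¹          ≈⟨ conj-⁻¹ x₂ y ⟩
      x₂ ∙ y ⁻¹ ∙ x₂ ⁻¹            ≈⟨ ∙-congʳ x₂∙y⁻¹≈y^-k∙x₂ ⟩
      y ^ℤ (- k) ∙ x₂ ∙ x₂ ⁻¹      ≈⟨ assoc _ _ _ ⟩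
      y ^ℤ (- k) ∙ (x₂ ∙ x₂ ⁻¹)    ≈⟨ ∙-congˡ (inverseʳ x₂) ⟩
      y ^ℤ (- k) ∙ ε               ≈⟨ identityʳ _ ⟩
      y ^ℤ (- k)                   ≈⟨ ^ℤ-neg y k ⟩
      (y ^ℤ k) ⁻¹                  ∎)

    x₂∙y^a≈y^[k*a]∙x₂ : ∀ a → x₂ ∙ y ^ℤ a ≈ y ^ℤ (k ℤ.* a) ∙ x₂
    x₂∙y^a≈y^[k*a]∙x₂ a = begin
      x₂ ∙ y ^ℤ a                    ≈⟨ identityʳ _ ⟨
      x₂ ∙ y ^ℤ a ∙ ε                ≈⟨ ∙-congˡ (inverseˡ x₂) ⟨
      x₂ ∙ y ^ℤ a ∙ (x₂ ⁻¹ ∙ x₂)     ≈⟨ assoc _ _ _ ⟨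
      x₂ ∙ y ^ℤ a ∙ x₂ ⁻¹ ∙ x₂       ≈⟨ ∙-congʳ (^ℤ-conj x₂ y a) ⟩
      (x₂ ∙ y ∙ x₂ ⁻¹) ^ℤ a ∙ x₂     ≈⟨ ∙-congʳ (^ℤ-cong a y-conj) ⟩
      (y ^ℤ k) ^ℤ a ∙ x₂             ≈⟨ ∙-congʳ (^ℤ-homo-* y k a) ⟨
      y ^ℤ (k ℤ.* a) ∙ x₂            ∎

    x₂∙y≈y^k∙x₂ : x₂ ∙ y ≈ y ^ℤ k ∙ x₂
    x₂∙y≈y^k∙x₂ = begin
      x₂ ∙ y                 ≈⟨ ∙-congˡ (identityʳ y) ⟨
      x₂ ∙ y ^ℤ 1ℤ           ≈⟨ x₂∙y^a≈y^[k*a]∙x₂ 1ℤ ⟩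
      y ^ℤ (k ℤ.* 1ℤ) ∙ x₂   ≡⟨ ≡.cong (λ e → y ^ℤ e ∙ x₂) (ℤ.*-identityʳ k) ⟩
      y ^ℤ k ∙ x₂            ∎

    y^odd-not-involution : ∀ {u} → ¬ + 2 ∣ₛ u → ¬ y ^ℤ u ∙ y ^ℤ u ≈ ε
    y^odd-not-involution {u} 2∤u y^u∙y^u≈ε = 2∤u (∣-trans 2∣2^l (y^[q*2]≈ε⇒2^l∣q (begin
      y ^ℤ (u ℤ.* + 2)         ≈⟨ ^ℤ-homo-* y u (+ 2) ⟩
      y ^ℤ u ∙ (y ^ℤ u ∙ ε)    ≈⟨ ∙-congˡ (identityʳ _) ⟩
      y ^ℤ u ∙ y ^ℤ u          ≈⟨ y^u∙y^u≈ε ⟩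
      ε                        ∎)))

    [y^m∙x₂]²≈y^[m+k*m] : ∀ m → (y ^ℤ m ∙ x₂) ∙ (y ^ℤ m ∙ x₂) ≈ y ^ℤ (m + k ℤ.* m)
    [y^m∙x₂]²≈y^[m+k*m] m = begin
      (y ^ℤ m ∙ x₂) ∙ (y ^ℤ m ∙ x₂)        ≈⟨ assoc _ _ _ ⟩
      y ^ℤ m ∙ (x₂ ∙ (y ^ℤ m ∙ x₂))        ≈⟨ ∙-congˡ (assoc _ _ _) ⟨
      y ^ℤ m ∙ (x₂ ∙ y ^ℤ m ∙ x₂)          ≈⟨ ∙-congˡ (∙-congʳ (x₂∙y^a≈y^[k*a]∙x₂ m)) ⟩
      y ^ℤ m ∙ (y ^ℤ (k ℤ.* m) ∙ x₂ ∙ x₂)  ≈⟨ ∙-congˡ (assoc _ _ _) ⟩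
      y ^ℤ m ∙ (y ^ℤ (k ℤ.* m) ∙ (x₂ ∙ x₂)) ≈⟨ ∙-congˡ (∙-congˡ x₂∙x₂≈ε) ⟩
      y ^ℤ m ∙ (y ^ℤ (k ℤ.* m) ∙ ε)        ≈⟨ ∙-congˡ (identityʳ _) ⟩
      y ^ℤ m ∙ y ^ℤ (k ℤ.* m)              ≈⟨ ^ℤ-homo-+ y m (k ℤ.* m) ⟨
      y ^ℤ (m + k ℤ.* m)                   ∎

    y^odd∙x₂-not-involution : ∀ {m} → ¬ + 2 ∣ₛ m → ¬ (y ^ℤ m ∙ x₂) ∙ (y ^ℤ m ∙ x₂) ≈ ε
    y^odd∙x₂-not-involution {m} 2∤m [y^m∙x₂]²≈ε with 2∣k+1
    ... | divides j k+1≡j*2 = 2^[l+1]∤k+1 (≡.subst₂ _∣ₛ_ 2^l*2≡2^[l+1] (≡.sym k+1≡j*2)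
                                 (*-monoˡ-∣ (+ 2) (pˡ∣i*j⇒pˡ∣j l prime[2] 2∤m 2^l∣m*j)))
      where
      m+k*m≡[m*j]*2 : m + k ℤ.* m ≡ (m ℤ.* j) ℤ.* + 2
      m+k*m≡[m*j]*2 = ≡.trans (factor m k) (≡.trans (≡.cong (ℤ._* m) k+1≡j*2) (regroup j m))
        where
        factor : ∀ m k → m + k ℤ.* m ≡ (k + 1ℤ) ℤ.* m
        factor = solve-∀
        regroup : ∀ j m → (j ℤ.* + 2) ℤ.* m ≡ (m ℤ.* j) ℤ.* + 2
        regroup = solve-∀

      2^l∣m*j : + (2 ^ l) ∣ₛ m ℤ.* j
      2^l∣m*j = y^[q*2]≈ε⇒2^l∣q (begin
        y ^ℤ ((m ℤ.* j) ℤ.* + 2)          ≡⟨ ≡.cong (y ^ℤ_) m+k*m≡[m*j]*2 ⟨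
        y ^ℤ (m + k ℤ.* m)                ≈⟨ [y^m∙x₂]²≈y^[m+k*m] m ⟨
        (y ^ℤ m ∙ x₂) ∙ (y ^ℤ m ∙ x₂)     ≈⟨ [y^m∙x₂]²≈ε ⟩
        ε                                 ∎)

      2^l*2≡2^[l+1] : + (2 ^ l) ℤ.* + 2 ≡ + (2 ^ suc l)
      2^l*2≡2^[l+1] = ≡.trans (≡.sym (ℤ.pos-* (2 ^ l) 2)) (≡.cong +_ (ℕ.*-comm (2 ^ l) 2))

    NormalForm : Carrier → Set ℓ
    NormalForm g = ∃ λ e → + 2 ∣ₛ e × (g ≈ y ^ℤ e ⊎ g ≈ y ^ℤ e ∙ x₂)

    nf-resp : ∀ {g h} → g ≈ h → NormalForm g → NormalForm h
    nf-resp g≈h (e , 2∣e , inj₁ g≈y^e)    = e , 2∣e , inj₁ (trans (sym g≈h) g≈y^e)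
    nf-resp g≈h (e , 2∣e , inj₂ g≈y^e∙x₂) = e , 2∣e , inj₂ (trans (sym g≈h) g≈y^e∙x₂)

    nf-y^ : ∀ {e} → + 2 ∣ₛ e → NormalForm (y ^ℤ e)
    nf-y^ 2∣e = _ , 2∣e , inj₁ refl

    nf-x₂ : NormalForm x₂
    nf-x₂ = 0ℤ , divides 0ℤ ≡.refl , inj₂ (sym (identityˡ x₂))

    nf-x₁ : NormalForm x₁
    nf-x₁ = nf-resp (sym x₁≈y^-2) (nf-y^ (divides -1ℤ ≡.refl))

    nf-∙y^ : ∀ {g f} → NormalForm g → + 2 ∣ₛ f → NormalForm (g ∙ y ^ℤ f)
    nf-∙y^ {g} {f} (e , 2∣e , inj₁ g≈y^e) 2∣f = e + f , ∣m∣n⇒∣m+n 2∣e 2∣f , inj₁ (begin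
      g ∙ y ^ℤ f          ≈⟨ ∙-congʳ g≈y^e ⟩
      y ^ℤ e ∙ y ^ℤ f     ≈⟨ ^ℤ-homo-+ y e f ⟨
      y ^ℤ (e + f)        ∎)
    nf-∙y^ {g} {f} (e , 2∣e , inj₂ g≈y^e∙x₂) 2∣f =
      e + k ℤ.* f , ∣m∣n⇒∣m+n 2∣e (∣n⇒∣m*n k 2∣f) , inj₂ (begin
        g ∙ y ^ℤ f                    ≈⟨ ∙-congʳ g≈y^e∙x₂ ⟩
        y ^ℤ e ∙ x₂ ∙ y ^ℤ f          ≈⟨ assoc _ _ _ ⟩
        y ^ℤ e ∙ (x₂ ∙ y ^ℤ f)        ≈⟨ ∙-congˡ (x₂∙y^a≈y^[k*a]∙x₂ f) ⟩
        y ^ℤ e ∙ (y ^ℤ (k ℤ.* f) ∙ x₂) ≈⟨ assoc _ _ _ ⟨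
        y ^ℤ e ∙ y ^ℤ (k ℤ.* f) ∙ x₂   ≈⟨ ∙-congʳ (^ℤ-homo-+ y e (k ℤ.* f)) ⟨
        y ^ℤ (e + k ℤ.* f) ∙ x₂        ∎)

    nf-∙x₂ : ∀ {g} → NormalForm g → NormalForm (g ∙ x₂)
    nf-∙x₂ (e , 2∣e , inj₁ g≈y^e)        = e , 2∣e , inj₂ (∙-congʳ g≈y^e)
    nf-∙x₂ {g} (e , 2∣e , inj₂ g≈y^e∙x₂) = e , 2∣e , inj₁ (begin
      g ∙ x₂                ≈⟨ ∙-congʳ g≈y^e∙x₂ ⟩
      y ^ℤ e ∙ x₂ ∙ x₂      ≈⟨ assoc _ _ _ ⟩
      y ^ℤ e ∙ (x₂ ∙ x₂)    ≈⟨ ∙-congˡ x₂∙x₂≈ε ⟩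
      y ^ℤ e ∙ ε            ≈⟨ identityʳ _ ⟩
      y ^ℤ e                ∎)

    nf-∙ : ∀ {g h} → NormalForm g → NormalForm h → NormalForm (g ∙ h)
    nf-∙ nf-g (f , 2∣f , inj₁ h≈y^f) =
      nf-resp (∙-congˡ (sym h≈y^f)) (nf-∙y^ nf-g 2∣f)
    nf-∙ nf-g (f , 2∣f , inj₂ h≈y^f∙x₂) =
      nf-resp (trans (assoc _ _ _) (∙-congˡ (sym h≈y^f∙x₂))) (nf-∙x₂ (nf-∙y^ nf-g 2∣f))

    nf-⁻¹ : ∀ {g} → NormalForm g → NormalForm (g ⁻¹)
    nf-⁻¹ {g} (e , 2∣e , inj₁ g≈y^e) = nf-resp y^-e≈g⁻¹ (nf-y^ (∣m⇒∣-m 2∣e))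
      where
      y^-e≈g⁻¹ : y ^ℤ (- e) ≈ g ⁻¹
      y^-e≈g⁻¹ = trans (^ℤ-neg y e) (⁻¹-cong (sym g≈y^e))
    nf-⁻¹ {g} (e , 2∣e , inj₂ g≈y^e∙x₂) = nf-resp x₂∙y^-e≈g⁻¹ (nf-∙ nf-x₂ (nf-y^ (∣m⇒∣-m 2∣e)))
      where
      x₂∙y^-e≈g⁻¹ : x₂ ∙ y ^ℤ (- e) ≈ g ⁻¹
      x₂∙y^-e≈g⁻¹ = begin
        x₂ ∙ y ^ℤ (- e)         ≈⟨ ∙-cong (inverseˡ-unique x₂ x₂ x₂∙x₂≈ε) (^ℤ-neg y e) ⟩
        x₂ ⁻¹ ∙ (y ^ℤ e) ⁻¹     ≈⟨ ⁻¹-anti-homo-∙ (y ^ℤ e) x₂ ⟨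
        (y ^ℤ e ∙ x₂) ⁻¹        ≈⟨ ⁻¹-cong g≈y^e∙x₂ ⟨
        g ⁻¹                    ∎

    nf-y∙h∙y : ∀ {h} → NormalForm h → NormalForm (y ∙ h ∙ y)
    nf-y∙h∙y {h} (e , 2∣e , inj₁ h≈y^e) =
      nf-resp y^e∙y^2≈y∙h∙y (nf-∙ (nf-y^ 2∣e) (nf-y^ (divides 1ℤ ≡.refl)))
      where
      y^e∙y^2≈y∙h∙y : y ^ℤ e ∙ y ^ℤ (+ 2) ≈ y ∙ h ∙ y
      y^e∙y^2≈y∙h∙y = begin
        y ^ℤ e ∙ y ^ℤ (+ 2)   ≈⟨ ∙-congˡ (∙-congˡ (identityʳ y)) ⟩
        y ^ℤ e ∙ (y ∙ y)      ≈⟨ assoc _ _ _ ⟨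
        y ^ℤ e ∙ y ∙ y        ≈⟨ ∙-congʳ (∙-^ℤ-comm y e) ⟨
        y ∙ y ^ℤ e ∙ y        ≈⟨ ∙-congʳ (∙-congˡ h≈y^e) ⟨
        y ∙ h ∙ y             ∎
    nf-y∙h∙y {h} (e , 2∣e , inj₂ h≈y^e∙x₂) =
      nf-resp y^e∙y^[k+1]∙x₂≈y∙h∙y (nf-∙ (nf-∙ (nf-y^ 2∣e) (nf-y^ 2∣k+1)) nf-x₂)
      where
      y∙y^k≈y^[k+1] : y ∙ y ^ℤ k ≈ y ^ℤ (k + 1ℤ)
      y∙y^k≈y^[k+1] = begin
        y ∙ y ^ℤ k           ≈⟨ ∙-^ℤ-comm y k ⟩
        y ^ℤ k ∙ y           ≈⟨ ∙-congˡ (identityʳ y) ⟨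
        y ^ℤ k ∙ y ^ℤ 1ℤ     ≈⟨ ^ℤ-homo-+ y k 1ℤ ⟨
        y ^ℤ (k + 1ℤ)        ∎

      y^e∙y^[k+1]∙x₂≈y∙h∙y : y ^ℤ e ∙ y ^ℤ (k + 1ℤ) ∙ x₂ ≈ y ∙ h ∙ y
      y^e∙y^[k+1]∙x₂≈y∙h∙y = begin
        y ^ℤ e ∙ y ^ℤ (k + 1ℤ) ∙ x₂     ≈⟨ assoc _ _ _ ⟩
        y ^ℤ e ∙ (y ^ℤ (k + 1ℤ) ∙ x₂)   ≈⟨ ∙-congˡ (∙-congʳ y∙y^k≈y^[k+1]) ⟨
        y ^ℤ e ∙ (y ∙ y ^ℤ k ∙ x₂)      ≈⟨ ∙-congˡ (assoc _ _ _) ⟩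
        y ^ℤ e ∙ (y ∙ (y ^ℤ k ∙ x₂))    ≈⟨ assoc _ _ _ ⟨
        y ^ℤ e ∙ y ∙ (y ^ℤ k ∙ x₂)      ≈⟨ ∙-cong (∙-^ℤ-comm y e) x₂∙y≈y^k∙x₂ ⟨
        y ∙ y ^ℤ e ∙ (x₂ ∙ y)           ≈⟨ assoc _ _ _ ⟨
        y ∙ y ^ℤ e ∙ x₂ ∙ y             ≈⟨ ∙-congʳ (assoc _ _ _) ⟩
        y ∙ (y ^ℤ e ∙ x₂) ∙ y           ≈⟨ ∙-congʳ (∙-congˡ h≈y^e∙x₂) ⟨
        y ∙ h ∙ y                       ∎

    ¬nf-y^odd : ∀ {u} → ¬ + 2 ∣ₛ u → ¬ NormalForm (y ^ℤ u)
    ¬nf-y^odd {u} 2∤u (e , 2∣e , form) =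
      y^odd-not-involution (∣m⇒∤n⇒∤m+n (∣m⇒∣-m 2∣e) 2∤u) (y^[-e+u]²≈ε form)
      where
      y^[-e+u]≈ : ∀ {z} → y ^ℤ u ≈ y ^ℤ e ∙ z → y ^ℤ (- e + u) ≈ z
      y^[-e+u]≈ {z} y^u≈y^e∙z = begin
        y ^ℤ (- e + u)               ≈⟨ ^ℤ-homo-+ y (- e) u ⟩
        y ^ℤ (- e) ∙ y ^ℤ u          ≈⟨ ∙-cong (^ℤ-neg y e) y^u≈y^e∙z ⟩
        (y ^ℤ e) ⁻¹ ∙ (y ^ℤ e ∙ z)   ≈⟨ \\-leftDividesʳ (y ^ℤ e) z ⟩
        z                            ∎

      y^[-e+u]²≈ε : y ^ℤ u ≈ y ^ℤ e ⊎ y ^ℤ u ≈ y ^ℤ e ∙ x₂ → y ^ℤ (- e + u) ∙ y ^ℤ (- e + u) ≈ ε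
      y^[-e+u]²≈ε (inj₁ y^u≈y^e) =
        let y^[-e+u]≈ε = y^[-e+u]≈ (trans y^u≈y^e (sym (identityʳ _))) in
        trans (∙-cong y^[-e+u]≈ε y^[-e+u]≈ε) (identityʳ ε)
      y^[-e+u]²≈ε (inj₂ y^u≈y^e∙x₂) =
        let y^[-e+u]≈x₂ = y^[-e+u]≈ y^u≈y^e∙x₂ in
        trans (∙-cong y^[-e+u]≈x₂ y^[-e+u]≈x₂) x₂∙x₂≈ε

    ¬nf-y : ¬ NormalForm y
    ¬nf-y = ¬nf-y^odd 2∤1 ∘ nf-resp (sym (identityʳ y))

    nf⇒c∙y⁻¹-not-involution : ∀ {c} → NormalForm c → ¬ (c ∙ y ⁻¹) ∙ (c ∙ y ⁻¹) ≈ ε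
    nf⇒c∙y⁻¹-not-involution {c} (e , 2∣e , inj₁ c≈y^e) [c∙y⁻¹]²≈ε =
      y^odd-not-involution (∣m⇒∤n⇒∤m+n 2∣e (∤m⇒∤-m 2∤1))
        (trans (∙-cong y^[e-1]≈c∙y⁻¹ y^[e-1]≈c∙y⁻¹) [c∙y⁻¹]²≈ε)
      where
      y^[e-1]≈c∙y⁻¹ : y ^ℤ (e + -1ℤ) ≈ c ∙ y ⁻¹
      y^[e-1]≈c∙y⁻¹ = begin
        y ^ℤ (e + -1ℤ)        ≈⟨ ^ℤ-homo-+ y e -1ℤ ⟩
        y ^ℤ e ∙ y ^ℤ -1ℤ     ≈⟨ ∙-cong (sym c≈y^e) (identityʳ (y ⁻¹)) ⟩
        c ∙ y ⁻¹              ∎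
    nf⇒c∙y⁻¹-not-involution {c} (e , 2∣e , inj₂ c≈y^e∙x₂) [c∙y⁻¹]²≈ε =
      y^odd∙x₂-not-involution (∣m⇒∤n⇒∤m+n 2∣e (∤m⇒∤-m 2∤k))
        (trans (∙-cong y^[e-k]∙x₂≈c∙y⁻¹ y^[e-k]∙x₂≈c∙y⁻¹) [c∙y⁻¹]²≈ε)
      where
      y^[e-k]∙x₂≈c∙y⁻¹ : y ^ℤ (e + - k) ∙ x₂ ≈ c ∙ y ⁻¹
      y^[e-k]∙x₂≈c∙y⁻¹ = begin
        y ^ℤ (e + - k) ∙ x₂         ≈⟨ ∙-congʳ (^ℤ-homo-+ y e (- k)) ⟩
        y ^ℤ e ∙ y ^ℤ (- k) ∙ x₂    ≈⟨ assoc _ _ _ ⟩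
        y ^ℤ e ∙ (y ^ℤ (- k) ∙ x₂)  ≈⟨ ∙-congˡ x₂∙y⁻¹≈y^-k∙x₂ ⟨
        y ^ℤ e ∙ (x₂ ∙ y ⁻¹)        ≈⟨ assoc _ _ _ ⟨
        y ^ℤ e ∙ x₂ ∙ y ⁻¹          ≈⟨ ∙-congʳ c≈y^e∙x₂ ⟨
        c ∙ y ⁻¹                    ∎

-- Opened only now: the operations of Defs would clash with the field names of Group above.
open import Defs
open import Data.Integer.Divisibility using (_∣_)
open import Data.Fin.Permutation using (_≈_; id; _⟨$⟩ʳ_; _⟨$⟩ˡ_; inverseˡ; inverseʳ)

-- Pointwise equality of permutations, wrapped in a record so that unification can recover the
-- permutations from an equation between them.
infix 4 _≋_
record _≋_ {n} (g h : Sym n) : Set where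
  constructor mk≋
  field pointwise : g ≈ h
open _≋_

Sym-group : ℕ → Group 0ℓ 0ℓ
Sym-group n = record
  { Carrier = Sym n
  ; _≈_     = _≋_
  ; _∙_     = _·_
  ; ε       = id
  ; _⁻¹     = _⁻¹
  ; isGroup = record
    { isMonoid = record
      { isSemigroup = record
        { isMagma = record
          { isEquivalence = record
            { refl  = mk≋ λ _ → ≡.refl
            ; sym   = λ (mk≋ p) → mk≋ λ i → ≡.sym (p i)
            ; trans = λ (mk≋ p) (mk≋ q) → mk≋ λ i → ≡.trans (p i) (q i)
            }
          ; ∙-cong = λ {_} {_} {h} (mk≋ p) (mk≋ q) → mk≋ λ i → ≡.trans (≡.cong (h ⟨$⟩ʳ_) (p i)) (q _)
          }
        ; assoc = λ _ _ _ → mk≋ λ _ → ≡.refl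
        }
      ; identity = (λ _ → mk≋ λ _ → ≡.refl) , (λ _ → mk≋ λ _ → ≡.refl)
      }
    ; inverse = (λ g → mk≋ λ _ → inverseʳ g) , (λ g → mk≋ λ _ → inverseˡ g)
    ; ⁻¹-cong = λ {g} {h} (mk≋ p) → mk≋ λ i →
        ≡.trans (≡.cong (g ⟨$⟩ˡ_) (≡.trans (≡.sym (inverseʳ h)) (≡.sym (p _)))) (inverseˡ g)
    }
  }

module _ {n : ℕ} where

  open Group (Sym-group n) using (refl; sym; trans; ∙-cong; identityʳ)
  open GroupIdentities (Sym-group n) using ([c∙g⁻¹]⁻¹≈[g∙c⁻¹∙g]∙g⁻¹; x⁻¹≈x⇒x∙x≈ε)
  open IntegerPowers (Sym-group n) using (_^ℤ_; order-∣)

  ^ᵖ≋^ℤ : ∀ (g : Sym n) m → g ^ᵖ m ≋ g ^ℤ (+ m)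
  ^ᵖ≋^ℤ g zero    = refl
  ^ᵖ≋^ℤ g (suc m) = ∙-cong (refl {g}) (^ᵖ≋^ℤ g m)

  ^ᶻ≋^ℤ : ∀ (g : Sym n) a → g ^ᶻ a ≋ g ^ℤ a
  ^ᶻ≋^ℤ g (+ m)    = ^ᵖ≋^ℤ g m
  ^ᶻ≋^ℤ g -[1+ m ] = ^ᵖ≋^ℤ (g ⁻¹) (suc m)

  hasOrder⇒∣ : ∀ {g : Sym n} {m} → HasOrder g m → ∀ {a} → g ^ℤ a ≋ id → + m ∣ₛ a
  hasOrder⇒∣ {g} {m} (0<m , gᵐ≈id , minimal) = order-∣ 0<m (trans (sym (^ᵖ≋^ℤ g m)) (mk≋ gᵐ≈id)) r≡0
    where
    r≡0 : ∀ r → r ℕ.< m → g ^ℤ (+ r) ≋ id → r ≡ 0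
    r≡0 zero    _   _      = ≡.refl
    r≡0 (suc j) j<m gʳ≋id =
      ⊥-elim (minimal (suc j) (ℕ.s≤s ℕ.z≤n) j<m (pointwise (trans (^ᵖ≋^ℤ g (suc j)) gʳ≋id)))

  gen-^ℤ : ∀ {a b g : Sym n} → Gen a b g → ∀ e → Gen a b (g ^ℤ e)
  gen-^ℤ {a} {b} g∈ (+ m)    = gen-^ℕ g∈ m
    where
    gen-^ℕ : ∀ {g} → Gen a b g → ∀ m → Gen a b (g ^ℤ (+ m))
    gen-^ℕ g∈ zero    = gen-1
    gen-^ℕ g∈ (suc m) = gen-· g∈ (gen-^ℕ g∈ m)
  gen-^ℤ g∈ -[1+ m ] = gen-^ℤ (gen-⁻¹ g∈) (+ suc m)

  perfect-code⇒coset-involution : ∀ {S C : Sym n → Set} {g} → IsConnectionSet S → IsPerfectCodeIn S C →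
    ¬ C g → (∀ {h} → C h → C (g · h ⁻¹ · g)) → ∃ λ c → C c × (c · g ⁻¹) · (c · g ⁻¹) ≋ id
  perfect-code⇒coset-involution {g = g} (S-resp , _ , S-inv) (_ , covered) g∉C closed
    with covered g g∉C
  ... | c , c∈C , c·g⁻¹∈S , unique =
    c , c∈C , x⁻¹≈x⇒x∙x≈ε (trans [c·g⁻¹]⁻¹≋c′·g⁻¹ (∙-cong c′≋c (refl {g ⁻¹})))
    where
    c′ : Sym n
    c′ = g · c ⁻¹ · g

    [c·g⁻¹]⁻¹≋c′·g⁻¹ : (c · g ⁻¹) ⁻¹ ≋ c′ · g ⁻¹
    [c·g⁻¹]⁻¹≋c′·g⁻¹ = [c∙g⁻¹]⁻¹≈[g∙c⁻¹∙g]∙g⁻¹ c g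

    c′≋c : c′ ≋ c
    c′≋c = mk≋ (unique c′ (closed c∈C) (S-resp (S-inv _ c·g⁻¹∈S) (pointwise [c·g⁻¹]⁻¹≋c′·g⁻¹)))

  module _ {l : ℕ} {x₁ x₂ y : Sym n} {k : ℤ}
    (x₁-order : HasOrder x₁ (2 ^ l))
    (x₂-order : HasOrder x₂ 2)
    (y·y≈x₁⁻¹ : y · y ≈ x₁ ⁻¹)
    (x₂·y⁻¹≈y^ᶻ-k·x₂ : x₂ · y ⁻¹ ≈ y ^ᶻ (- k) · x₂)
    (2∤k : ¬ + 2 ∣ₛ k)
    (2^[l+1]∤k+1 : ¬ + (2 ^ suc l) ∣ₛ k + 1ℤ)
    where

    x₂·x₂≋id : x₂ · x₂ ≋ id
    x₂·x₂≋id = trans (∙-cong (refl {x₂}) (sym (identityʳ x₂))) (mk≋ (proj₁ (proj₂ x₂-order)))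

    x₁^a≋id⇒2^l∣a : ∀ {a} → x₁ ^ℤ a ≋ id → + (2 ^ l) ∣ₛ a
    x₁^a≋id⇒2^l∣a = hasOrder⇒∣ x₁-order

    x₂·y⁻¹≋y^-k·x₂ : x₂ · y ⁻¹ ≋ y ^ℤ (- k) · x₂
    x₂·y⁻¹≋y^-k·x₂ = trans (mk≋ x₂·y⁻¹≈y^ᶻ-k·x₂) (∙-cong (^ᶻ≋^ℤ y (- k)) (refl {x₂}))

    open SquareRootCoset (Sym-group n) {x₁} {x₂} {y} {k} {l}
      x₁^a≋id⇒2^l∣a x₂·x₂≋id (mk≋ y·y≈x₁⁻¹) x₂·y⁻¹≋y^-k·x₂ 2∤k 2^[l+1]∤k+1

    gen⇒nf : ∀ {g} → Gen x₁ x₂ g → NormalForm g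
    gen⇒nf gen-a          = nf-x₁
    gen⇒nf gen-b          = nf-x₂
    gen⇒nf gen-1          = nf-y^ (divides 0ℤ ≡.refl)
    gen⇒nf (gen-· g∈ h∈)  = nf-∙ (gen⇒nf g∈) (gen⇒nf h∈)
    gen⇒nf (gen-⁻¹ g∈)    = nf-⁻¹ (gen⇒nf g∈)
    gen⇒nf (gen-≈ g∈ g≈h) = nf-resp (mk≋ g≈h) (gen⇒nf g∈)

    y^even∈H : ∀ {e} → + 2 ∣ₛ e → Gen x₁ x₂ (y ^ℤ e)
    y^even∈H (divides q ≡.refl) = gen-≈ (gen-^ℤ (gen-⁻¹ gen-a) q) (pointwise (sym (y^[q*2]≈x₁⁻¹^q q)))

    nf⇒gen : ∀ {g} → NormalForm g → Gen x₁ x₂ g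
    nf⇒gen (_ , 2∣e , inj₁ g≋y^e)    = gen-≈ (y^even∈H 2∣e) (pointwise (sym g≋y^e))
    nf⇒gen (_ , 2∣e , inj₂ g≋y^e·x₂) = gen-≈ (gen-· (y^even∈H 2∣e) gen-b) (pointwise (sym g≋y^e·x₂))

    y∉H : ¬ Gen x₁ x₂ y
    y∉H y∈H = ¬nf-y (gen⇒nf y∈H)

    H-closed : ∀ {h} → Gen x₁ x₂ h → Gen x₁ x₂ (y · h ⁻¹ · y)
    H-closed h∈H = nf⇒gen (nf-y∙h∙y (nf-⁻¹ (gen⇒nf h∈H)))

    no-involution-in-H·y⁻¹ : ¬ (∃ λ c → Gen x₁ x₂ c × (c · y ⁻¹) · (c · y ⁻¹) ≋ id)
    no-involution-in-H·y⁻¹ (c , c∈H , [c·y⁻¹]²≋id) = nf⇒c∙y⁻¹-not-involution (gen⇒nf c∈H) [c·y⁻¹]²≋id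

    ¬perfect-code : ¬ IsPerfectCodeOfSym (Gen x₁ x₂)
    ¬perfect-code (_ , S-connection , H-perfect) =
      no-involution-in-H·y⁻¹ (perfect-code⇒coset-involution S-connection H-perfect y∉H H-closed)

theorem6 : (n l : ℕ) (x₁ x₂ : Sym n) →
    NonCommutative (Gen x₁ x₂) →
    HasCard (Gen x₁ x₂) (2 ^ suc l) →
    HasOrder x₁ (2 ^ l) →
    HasOrder x₂ 2 →
    (y : Sym n) → (y · y) ≈ (x₁ ⁻¹) →
    (k : ℤ) → ¬ ((+ 2) ∣ k) → ¬ ((+ (2 ^ suc l)) ∣ (k + + 1)) →
    (x₂ · (y ⁻¹)) ≈ ((y ^ᶻ (- k)) · x₂) →
    ¬ IsPerfectCodeOfSym (Gen x₁ x₂)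
theorem6 n l x₁ x₂ _ _ x₁-order x₂-order y y·y≈x₁⁻¹ k 2∤k 2^[l+1]∤k+1 x₂·y⁻¹≈y^ᶻ-k·x₂ =
  ¬perfect-code {n} {l} {x₁} {x₂} {y} {k} x₁-order x₂-order y·y≈x₁⁻¹ x₂·y⁻¹≈y^ᶻ-k·x₂
    (2∤k ∘ ∣⇒∣ᵤ) (2^[l+1]∤k+1 ∘ ∣⇒∣ᵤ)
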